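{- Let $X$ be a finite set of alternatives with $|X|=m\geq 3$ and $N=\{1,\dots,n\}$ with $n\geq 2$. If a social choice correspondence $G$ on $L(X)^N$ satisfies tops-only and the Pareto condition, then $G$ is unbalanced (does not satisfy balancedness).
   Context: An ordering on $X$ is a strict linear order on $X$; $L(X)$ is the set of all orderings; for an ordering $r$, $r[1]$ is its top element. A profile is $u=(u(1),\dots,u(n))\in L(X)^N$. A social choice correspondence is a map $G$ from $L(X)^N$ to non-empty subsets of $X$. $G$ satisfies tops-only if $G(u)=G(v)$ whenever $u(i)[1]=v(i)[1]$ for all $i$. $G$ satisfies the Pareto condition if whenever every individual ranks $x$ above $y$ at $u$, then $y\notin G(u)$. Profile $v$ is constructed from $u$ by transposition pair $(x,y)$ via individuals $i$ and $j$ if at $u$, $x$ is immediately above $y$ in $u(i)$ and $y$ is immediately above $x$ in $u(j)$, and $v$ equals $u$ except that $x$ and $y$ are swapped in the orderings of $i$ and $j$. $G$ is balanced if $G(v)=G(u)$ whenever $v$ is constructed from $u$ by some transposition pair via some two individuals; otherwise $G$ is unbalanced. -}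

module Defs where

open import Data.Nat using (ℕ; suc; _≥_)
open import Data.Fin using (Fin; zero; suc; inject₁; _<_)
open import Data.Fin.Subset using (Subset; _∈_; _∉_; Nonempty)
open import Data.Product using (Σ; _×_; ∃; _,_)
open import Function.Bundles using (_↔_; Inverse)
open import Relation.Binary.PropositionalEquality using (_≡_; _≢_)

-- An ordering (strict linear order) on Fin m is represented by a bijection
-- from positions to alternatives: position 0 is the top, position k+1 is
-- immediately below position k.
Ordering : ℕ → Set
Ordering m = Fin m ↔ Fin m

at : ∀ {m} → Ordering m → Fin m → Fin m
at r p = Inverse.to r p

pos : ∀ {m} → Ordering m → Fin m → Fin m
pos r x = Inverse.from r x

_≻[_]_ : ∀ {m} → Fin m → Ordering m → Fin m → Set
x ≻[ r ] y = pos r x < pos r y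

top : ∀ {m} → Ordering (suc m) → Fin (suc m)
top r = at r zero

Profile : ℕ → ℕ → Set
Profile n m = Fin n → Ordering m

record SCC (n m : ℕ) : Set where
  field
    choice   : Profile n m → Subset m
    nonempty : (u : Profile n m) → Nonempty (choice u)
open SCC public

TopsOnly : ∀ {n m} → SCC n (suc m) → Set
TopsOnly G = ∀ u v → (∀ i → top (u i) ≡ top (v i)) → choice G u ≡ choice G v

Pareto : ∀ {n m} → SCC n m → Set
Pareto G = ∀ u x y → (∀ i → x ≻[ u i ] y) → y ∉ choice G u

ImmAbove : ∀ {m} → Ordering (suc m) → Fin (suc m) → Fin (suc m) → Fin m → Set
ImmAbove r x y p = at r (inject₁ p) ≡ x × at r (suc p) ≡ y

SwapAt : ∀ {m} → Ordering (suc m) → Ordering (suc m) → Fin m → Set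
SwapAt r s p =
  at s (inject₁ p) ≡ at r (suc p) ×
  at s (suc p) ≡ at r (inject₁ p) ×
  (∀ q → q ≢ inject₁ p → q ≢ suc p → at s q ≡ at r q)

TranspositionPair : ∀ {n m} → Profile n (suc m) → Profile n (suc m)
                  → Fin (suc m) → Fin (suc m) → Fin n → Fin n → Set
TranspositionPair {n} {m} u v x y i j =
  i ≢ j ×
  Σ (Fin m) λ p → Σ (Fin m) λ q →
    ImmAbove (u i) x y p × ImmAbove (u j) y x q ×
    SwapAt (u i) (v i) p × SwapAt (u j) (v j) q ×
    (∀ k → k ≢ i → k ≢ j → ∀ r → at (v k) r ≡ at (u k) r)

Balanced : ∀ {n m} → SCC n (suc m) → Set
Balanced G = ∀ u v x y i j → TranspositionPair u v x y i j →
  choice G v ≡ choice G u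

-- Let u₀ be the profile in which individual 0 ranks b > a > c and everybody else c > a > b,
-- all other alternatives below. Nothing can be chosen at u₀. Alternative a: replace the
-- orderings by b > c > a and c > b > a, which keeps the tops, and now b Pareto dominates a.
-- Alternative b: the balanced swap of (b, a) between individual 0 and individual 1 produces
-- the tops a, c, …, c, which are also the tops of a profile where everybody prefers a to b.
-- Alternative c: individual 0 swaps a and c against one other individual at a time, who thus
-- moves from c > a > b to a > c > b; since the top b of individual 0 never changes, tops-only
-- restores b > a > c after each swap, and at the end everybody prefers a to c.
-- Any other alternative is Pareto dominated by b. This contradicts non-emptiness.
module Submission where

open import Defs
open import Data.Bool using (true; false; if_then_else_)
open import Data.Empty using (⊥-elim)
open import Data.Fin using (Fin; zero; suc; inject₁; toℕ; fromℕ<)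
open import Data.Fin.Patterns using (0F; 1F; 2F)
open import Data.Fin.Permutation using (transpose; _∘ₚ_; id)
import Data.Fin.Permutation.Components as PC
open import Data.Fin.Properties using (_≟_; toℕ-injective; toℕ-fromℕ<)
open import Data.Fin.Subset using (_∉_)
open import Data.Nat using (ℕ; zero; suc; _≥_; _≤_; _+_; _<ᵇ_; s≤s; z<s; s<s)
open import Data.Nat.Properties using (<⇒≤; ≤-refl)
open import Data.Product using (_,_)
open import Data.Vec.Functional using (_∷_; replicate)
open import Function using (_∘_)
open import Relation.Nullary using (¬_; yes; no)
open import Relation.Nullary.Decidable using (dec-true; dec-false)
open import Relation.Binary.PropositionalEquality

transpose-matchˡ : ∀ {n} (i j : Fin n) → PC.transpose i j i ≡ j
transpose-matchˡ i j rewrite dec-true (i ≟ i) refl = refl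

transpose-matchʳ : ∀ {n} (i j : Fin n) → PC.transpose i j j ≡ i
transpose-matchʳ i j with j ≟ i
... | yes j≡i = j≡i
... | no _ rewrite dec-true (j ≟ j) refl = refl

transpose-fixes : ∀ {n} {i j k : Fin n} → k ≢ i → k ≢ j → PC.transpose i j k ≡ k
transpose-fixes {i = i} {j} {k} k≢i k≢j rewrite dec-false (k ≟ i) k≢i | dec-false (k ≟ j) k≢j = refl

swapAdjacent : ∀ {m} → Ordering (suc m) → Fin m → Ordering (suc m)
swapAdjacent r p = transpose (inject₁ p) (suc p) ∘ₚ r

SwapAt-swapAdjacent : ∀ {m} (r : Ordering (suc m)) p → SwapAt r (swapAdjacent r p) p
SwapAt-swapAdjacent r p =
  cong (at r) (transpose-matchˡ (inject₁ p) (suc p)) ,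
  cong (at r) (transpose-matchʳ (inject₁ p) (suc p)) ,
  λ q q≢p q≢p+1 → cong (at r) (transpose-fixes q≢p q≢p+1)

SwapAt-swapAdjacent⁻¹ : ∀ {m} (r : Ordering (suc m)) p → SwapAt (swapAdjacent r p) r p
SwapAt-swapAdjacent⁻¹ r p with SwapAt-swapAdjacent r p
... | s₀≡r₁ , s₁≡r₀ , rest = sym s₁≡r₀ , sym s₀≡r₁ , λ q h h′ → sym (rest q h h′)

<ᵇ-irrefl : ∀ k → (k <ᵇ k) ≡ false
<ᵇ-irrefl zero = refl
<ᵇ-irrefl (suc k) = <ᵇ-irrefl k

n<ᵇ1+n : ∀ k → (k <ᵇ suc k) ≡ true
n<ᵇ1+n zero = refl
n<ᵇ1+n (suc k) = n<ᵇ1+n k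

<ᵇ-suc : ∀ {j k} → j ≢ k → (j <ᵇ suc k) ≡ (j <ᵇ k)
<ᵇ-suc {zero} {zero} j≢k = ⊥-elim (j≢k refl)
<ᵇ-suc {zero} {suc k} _ = refl
<ᵇ-suc {suc j} {zero} _ = refl
<ᵇ-suc {suc j} {suc k} j≢k = <ᵇ-suc (j≢k ∘ cong suc)

toℕ<ᵇn : ∀ {n} (i : Fin n) → (toℕ i <ᵇ n) ≡ true
toℕ<ᵇn zero = refl
toℕ<ᵇn (suc i) = toℕ<ᵇn i

transpositionPair : ∀ {n m} (u v : Profile n (suc m)) {x y i j p q r s r′ s′} →
  i ≢ j → u i ≡ r → v i ≡ s → u j ≡ r′ → v j ≡ s′ →
  ImmAbove r x y p → ImmAbove r′ y x q → SwapAt r s p → SwapAt r′ s′ q →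
  (∀ k → k ≢ i → k ≢ j → v k ≡ u k) → TranspositionPair u v x y i j
transpositionPair u v {p = p} {q} i≢j refl refl refl refl xy yx rs r′s′ rest =
  i≢j , p , q , xy , yx , rs , r′s′ , λ k k≢i k≢j t → cong (λ o → at o t) (rest k k≢i k≢j)

module ThreeAlternatives {m : ℕ} where

  -- Each ordering is named by its three top alternatives; the others stay below, in index order.

  a b c : Fin (3 + m)
  a = 0F
  b = 1F
  c = 2F

  abc bac acb bca cab cba : Ordering (3 + m)
  abc = id
  bac = swapAdjacent abc 0F
  acb = swapAdjacent abc 1F
  bca = swapAdjacent bac 1F
  cab = swapAdjacent acb 0F
  cba = swapAdjacent cab 1F

  staircase : ∀ {n} → Ordering (3 + m) → ℕ → Profile (suc n) (3 + m)
  staircase o k = o ∷ λ i → if toℕ i <ᵇ k then acb else cab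

module _ {n m : ℕ} (G : SCC (2 + n) (3 + m)) (tops-only : TopsOnly G) (pareto : Pareto G) where
  open ThreeAlternatives {m}

  u₀ : Profile (2 + n) (3 + m)
  u₀ = bac ∷ replicate _ cab

  ∉-resp-≡ : ∀ {x u v} → choice G u ≡ choice G v → x ∉ choice G v → x ∉ choice G u
  ∉-resp-≡ {x} Gu≡Gv = subst (λ S → x ∉ S) (sym Gu≡Gv)

  a∉u₀ : a ∉ choice G u₀
  a∉u₀ = ∉-resp-≡ (tops-only u₀ u λ { 0F → refl ; (suc _) → refl })
                  (pareto u b a λ { 0F → z<s ; (suc _) → s<s z<s })
    where u = bca ∷ replicate _ cba

  others∉u₀ : ∀ e → suc (suc (suc e)) ∉ choice G u₀
  others∉u₀ e = pareto u₀ b _ λ { 0F → z<s ; (suc _) → s<s (s<s z<s) }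

  module _ (balanced : Balanced G) where

    b∉u₀ : b ∉ choice G u₀
    b∉u₀ = ∉-resp-≡ (trans (sym (balanced u₀ v b a 0F 1F swapped))
                           (tops-only v w λ { 0F → refl ; 1F → refl ; (suc (suc _)) → refl }))
                    (pareto w a b λ { 0F → z<s ; (suc _) → s<s z<s })
      where
      v w : Profile (2 + n) (3 + m)
      v = abc ∷ cba ∷ replicate _ cab
      w = abc ∷ replicate _ cab
      swapped : TranspositionPair u₀ v b a 0F 1F
      swapped = transpositionPair u₀ v (λ ()) refl refl refl refl (refl , refl) (refl , refl)
        (SwapAt-swapAdjacent⁻¹ abc 0F) (SwapAt-swapAdjacent cab 1F)
        λ { 0F 0≢0 _ → ⊥-elim (0≢0 refl) ; 1F _ 1≢1 → ⊥-elim (1≢1 refl) ; (suc (suc _)) _ _ → refl }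

    staircase-step : ∀ (i : Fin (suc n)) k → toℕ i ≡ k →
      choice G (staircase bac k) ≡ choice G (staircase bac (suc k))
    staircase-step i k refl =
      trans (sym (balanced u v c a (suc i) 0F swapped)) (tops-only v w λ { 0F → refl ; (suc _) → refl })
      where
      u v w : Profile (2 + n) (3 + m)
      u = staircase bac k
      v = staircase bca (suc k)
      w = staircase bac (suc k)
      swapped : TranspositionPair u v c a (suc i) 0F
      swapped = transpositionPair u v (λ ())
        (cong (if_then acb else cab) (<ᵇ-irrefl k)) (cong (if_then acb else cab) (n<ᵇ1+n k))
        refl refl (refl , refl) (refl , refl)
        (SwapAt-swapAdjacent⁻¹ acb 0F) (SwapAt-swapAdjacent bac 1F)
        λ { 0F _ 0≢0 → ⊥-elim (0≢0 refl)
          ; (suc j) j≢i _ → cong (if_then acb else cab) (<ᵇ-suc (j≢i ∘ cong suc ∘ toℕ-injective)) }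

    staircase-chain : ∀ k → k ≤ suc n → choice G u₀ ≡ choice G (staircase bac k)
    staircase-chain zero _ = refl
    staircase-chain (suc k) k<1+n =
      trans (staircase-chain k (<⇒≤ k<1+n)) (staircase-step (fromℕ< k<1+n) k (toℕ-fromℕ< k<1+n))

    c∉u₀ : c ∉ choice G u₀
    c∉u₀ = ∉-resp-≡ (staircase-chain (suc n) ≤-refl) (pareto _ a c unanimous)
      where
      unanimous : ∀ i → a ≻[ staircase bac (suc n) i ] c
      unanimous 0F = s<s z<s
      unanimous (suc j) rewrite toℕ<ᵇn j = z<s

    nothing-chosen : ∀ x → x ∉ choice G u₀
    nothing-chosen 0F = a∉u₀
    nothing-chosen 1F = b∉u₀
    nothing-chosen 2F = c∉u₀
    nothing-chosen (suc (suc (suc e))) = others∉u₀ e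

  unbalanced : ¬ Balanced G
  unbalanced balanced = let x , x∈ = nonempty G u₀ in nothing-chosen balanced x x∈

mainTheorem3 : (n m : ℕ) → n ≥ 2 → suc m ≥ 3 →
    (G : SCC n (suc m)) → TopsOnly G → Pareto G → ¬ Balanced G
mainTheorem3 (suc (suc n)) (suc (suc m)) _ _ G = unbalanced G
mainTheorem3 0 _ () _
mainTheorem3 1 _ (s≤s ()) _
mainTheorem3 (suc (suc n)) 0 _ (s≤s ())
mainTheorem3 (suc (suc n)) 1 _ (s≤s (s≤s ()))
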